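{- Let $\phi$ be a formula and $\tau$ an $\mathcal A$-tree. Then $\mathrm{rm}(\tau,\phi)$ is an $\mathcal A$-tree and $\mathcal S(\mathrm{rm}(\tau,\phi))=\{C\in\mathcal S(\tau)\mid\phi\not\models_{\mathcal T} C\}$.
   Context: $\mathcal T$ is a theory; formulas are ground and quantifier-free. $\models_{\mathcal T}$ denotes entailment in all models of $\mathcal T$. A formula is $\mathcal T$-satisfiable if it has a model that is a model of $\mathcal T$. For a literal $l$, $\overline{l}$ is its complement. $\mathcal A$ is a fixed finite set of literals, and $<_t$ is a fixed total order on $\mathcal A$. Clauses are finite disjunctions of literals without repetition; $\bot$ is the empty clause. $\mathcal A$-trees are defined inductively. An $\mathcal A$-tree is either $\bot$, or a possibly empty finite set of pairs $\{l_1:\tau_1,\dots,l_n:\tau_n\}$, where: - the $l_i$ are pairwise distinct literals of $\mathcal A$; - each $\tau_i$ is an $\mathcal A$-tree containing only literals strictly $<_t$-greater than $l_i$. The associated clause set is $\mathcal S(\bot)=\{\bot\}$ and $\mathcal S(\{l_1:\tau_1,\dots,l_n:\tau_n\})=\bigcup_{i=1}^n\{l_i\vee C\mid C\in\mathcal S(\tau_i)\}$. $\mathrm{rm}(\tau,\phi)$ is defined as follows: - If $\phi$ is $\mathcal T$-unsatisfiable, then $\mathrm{rm}(\tau,\phi)=\emptyset$. - If $\phi$ is $\mathcal T$-satisfiable, then $\mathrm{rm}(\bot,\phi)=\bot$, and $\mathrm{rm}(\{l_1:\tau_1,\dots,l_n:\tau_n\},\phi)=\bigcup_{i=1}^n\{l_i:\mathrm{rm}(\tau_i,\phi\wedge\overline{l_i})\}$.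 -}

module Defs where

open import Data.Bool using (Bool; true; false; not; _∧_; _∨_; if_then_else_)
open import Data.List using (List; []; _∷_; map)
open import Data.Bool.ListAction using (any)
open import Data.List.Membership.Propositional using (_∈_)
open import Data.List.Relation.Unary.All using (All)
open import Data.List.Relation.Unary.Unique.Propositional using (Unique)
open import Data.Product using (Σ; _×_; _,_; proj₁; proj₂)
import Data.Sum
import Data.List
open import Relation.Binary.PropositionalEquality using (_≡_; _≢_)
open import Relation.Nullary using (Dec; yes; no; ¬_)

-- Ground quantifier-free logic over an abstract set of ground atoms.
-- A literal is an atom together with a polarity (true = positive).

Lit : Set → Set
Lit Atom = Atom × Bool

‾_ : {Atom : Set} → Lit Atom → Lit Atom
‾ (a , b) = a , not b

data Formula (Atom : Set) : Set where
  atom  : Atom → Formula Atom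
  ⊤F ⊥F : Formula Atom
  ¬F_   : Formula Atom → Formula Atom
  _∧F_  : Formula Atom → Formula Atom → Formula Atom
  _∨F_  : Formula Atom → Formula Atom → Formula Atom

litF : {Atom : Set} → Lit Atom → Formula Atom
litF (a , true)  = atom a
litF (a , false) = ¬F atom a

-- A theory T, presented by its class of models: `Model` is the type of
-- all models of T, and `val M a` is the truth value of the ground atom a
-- in the model M.  Satisfiability w.r.t. T is assumed decidable (the
-- definition of rm branches on it).

record Theory : Set₁ where
  field
    Atom  : Set
    Model : Set
    val   : Model → Atom → Bool

  evalF : Model → Formula Atom → Bool
  evalF M (atom a) = val M a
  evalF M ⊤F = true
  evalF M ⊥F = false
  evalF M (¬F φ) = not (evalF M φ)
  evalF M (φ ∧F ψ) = evalF M φ ∧ evalF M ψ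
  evalF M (φ ∨F ψ) = evalF M φ ∨ evalF M ψ

  evalL : Model → Lit Atom → Bool
  evalL M l = evalF M (litF l)

  -- clauses: finite disjunctions of literals; [] is the empty clause ⊥
  Clause : Set
  Clause = List (Lit Atom)

  evalC : Model → Clause → Bool
  evalC M C = any (evalL M) C

  Sat : Formula Atom → Set
  Sat φ = Σ Model λ M → evalF M φ ≡ true

  _⊨_ : Formula Atom → Clause → Set
  φ ⊨ C = (M : Model) → evalF M φ ≡ true → evalC M C ≡ true

-- 𝒜-trees (raw syntax; well-formedness is the predicate IsTree below).
-- bot is ⊥, node ps is the finite set of pairs {l₁:τ₁,…,lₙ:τₙ} listed in ps.

data Tree (L : Set) : Set where
  bot  : Tree L
  node : List (L × Tree L) → Tree L

module _ {L : Set} where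

  mutual
    lits : Tree L → List L
    lits bot = []
    lits (node ps) = litsL ps

    litsL : List (L × Tree L) → List L
    litsL [] = []
    litsL ((l , t) ∷ ps) = l ∷ (lits t Data.List.++ litsL ps)

  mutual
    data IsTree (𝒜 : List L) (_<t_ : L → L → Set) : Tree L → Set where
      bot-tree  : IsTree 𝒜 _<t_ bot
      node-tree : ∀ {ps} → Unique (map proj₁ ps) → IsTreeL 𝒜 _<t_ ps →
                  IsTree 𝒜 _<t_ (node ps)

    data IsTreeL (𝒜 : List L) (_<t_ : L → L → Set) : List (L × Tree L) → Set where
      []  : IsTreeL 𝒜 _<t_ []
      _∷_ : ∀ {l t ps} →
            (l ∈ 𝒜) × IsTree 𝒜 _<t_ t × All (l <t_) (lits t) →
            IsTreeL 𝒜 _<t_ ps → IsTreeL 𝒜 _<t_ ((l , t) ∷ ps)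

  mutual
    𝒮 : Tree L → List (List L)
    𝒮 bot = [] ∷ []
    𝒮 (node ps) = 𝒮L ps

    𝒮L : List (L × Tree L) → List (List L)
    𝒮L [] = []
    𝒮L ((l , t) ∷ ps) = map (l ∷_) (𝒮 t) Data.List.++ 𝒮L ps

record IsStrictTotalOrderOn {L : Set} (𝒜 : List L) (_<t_ : L → L → Set) : Set where
  field
    irrefl : ∀ {x} → x ∈ 𝒜 → ¬ (x <t x)
    trans  : ∀ {x y z} → x ∈ 𝒜 → y ∈ 𝒜 → z ∈ 𝒜 → x <t y → y <t z → x <t z
    total  : ∀ {x y} → x ∈ 𝒜 → y ∈ 𝒜 → x ≢ y → (x <t y) Data.Sum.⊎ (y <t x)

module RM (T : Theory) (sat? : (φ : Formula (Theory.Atom T)) → Dec (Theory.Sat T φ)) where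
  open Theory T

  mutual
    rm : Tree (Lit Atom) → Formula Atom → Tree (Lit Atom)
    rm τ φ with sat? φ
    ... | no _  = node []
    ... | yes _ = rm′ τ φ

    rm′ : Tree (Lit Atom) → Formula Atom → Tree (Lit Atom)
    rm′ bot φ = bot
    rm′ (node ps) φ = node (rmL ps φ)

    rmL : List (Lit Atom × Tree (Lit Atom)) → Formula Atom → List (Lit Atom × Tree (Lit Atom))
    rmL [] φ = []
    rmL ((l , t) ∷ ps) φ = (l , rm t (φ ∧F litF (‾ l))) ∷ rmL ps φ

module Submission where

-- Everything follows by structural recursion on τ, mirroring the
-- definition of rm, from two facts:
--   * entailment peels literals:  φ ⊨ l ∨ C  iff  φ ∧ l̄ ⊨ C
--     (a Boolean tautology applied model by model), which is exactly
--     how rm passes from a node l:τ′ to its subtree τ′;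
--   * an unsatisfiable φ entails every clause, while a satisfiable φ
--     does not entail the empty clause ⊥; these handle the two base
--     cases of rm.
-- Well-formedness is preserved because rm keeps the top-level labels of
-- every node (so uniqueness survives) and only ever deletes literals
-- (so every property of all literals of a subtree survives, in
-- particular "strictly greater than the parent label").

open import Defs
open import Data.Bool using (true; false; not; _∧_; _∨_)
open import Data.List using (List; []; _∷_; map; _++_)
open import Data.List.Membership.Propositional using (_∈_)
open import Data.List.Membership.Propositional.Properties
  using (∈-++⁻; ∈-++⁺ˡ; ∈-++⁺ʳ; ∈-map⁻; ∈-map⁺)
open import Data.List.Relation.Unary.Any using (here)
open import Data.List.Relation.Unary.All using (All; []; _∷_)
open import Data.List.Relation.Unary.All.Properties using (++⁻; ++⁺)
open import Data.List.Relation.Unary.Unique.Propositional using (Unique)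
open import Data.List.Relation.Unary.AllPairs using ([])
open import Data.Product using (_×_; _,_; proj₁)
open import Data.Sum using (inj₁; inj₂)
open import Data.Empty using (⊥-elim)
open import Relation.Nullary using (Dec; yes; no; ¬_)
open import Relation.Binary.PropositionalEquality using (_≡_; refl; sym; subst; cong)
open import Function.Bundles using (_⇔_; mk⇔; Equivalence)

implies-∨⇔ : ∀ a b c → (a ≡ true → b ∨ c ≡ true) ⇔ (a ∧ not b ≡ true → c ≡ true)
implies-∨⇔ false b     c = mk⇔ (λ _ ()) (λ _ ())
implies-∨⇔ true  true  c = mk⇔ (λ _ ()) (λ _ _ → refl)
implies-∨⇔ true  false c = mk⇔ (λ f → f) (λ f → f)

module Branch {L : Set} (l : L) (A B : List (List L)) where

  data View : List L → Set where
    child : ∀ {C} → C ∈ A → View (l ∷ C)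
    rest  : ∀ {C} → C ∈ B → View C

  view : ∀ {C} → C ∈ map (l ∷_) A ++ B → View C
  view p with ∈-++⁻ (map (l ∷_) A) p
  ... | inj₂ q = rest q
  ... | inj₁ q with ∈-map⁻ (l ∷_) q
  ...   | _ , q′ , refl = child q′

  child⁺ : ∀ {C} → C ∈ A → l ∷ C ∈ map (l ∷_) A ++ B
  child⁺ p = ∈-++⁺ˡ (∈-map⁺ (l ∷_) p)

  rest⁺ : ∀ {C} → C ∈ B → C ∈ map (l ∷_) A ++ B
  rest⁺ = ∈-++⁺ʳ (map (l ∷_) A)

module Entailment (T : Theory) where
  open Theory T

  evalL-‾ : ∀ M (l : Lit Atom) → evalF M (litF (‾ l)) ≡ not (evalL M l)
  evalL-‾ M (a , true)  = refl
  evalL-‾ M (a , false) with val M a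
  ... | true  = refl
  ... | false = refl

  ⊨-peel : ∀ φ l C → φ ⊨ (l ∷ C) ⇔ (φ ∧F litF (‾ l)) ⊨ C
  ⊨-peel φ l C = mk⇔ (λ f M → Equivalence.to (pointwise M) (f M))
                     (λ g M → Equivalence.from (pointwise M) (g M))
    where
      pointwise : ∀ M → (evalF M φ ≡ true → evalC M (l ∷ C) ≡ true)
                        ⇔ (evalF M (φ ∧F litF (‾ l)) ≡ true → evalC M C ≡ true)
      pointwise M rewrite evalL-‾ M l = implies-∨⇔ (evalF M φ) (evalL M l) (evalC M C)

  unsat⇒⊨ : ∀ φ → ¬ Sat φ → ∀ C → φ ⊨ C
  unsat⇒⊨ φ ¬sat C M e = ⊥-elim (¬sat (M , e))

  sat⇒⊭⊥ : ∀ φ → Sat φ → ¬ (φ ⊨ [])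
  sat⇒⊭⊥ φ (M , e) f with f M e
  ... | ()

module Removal (T : Theory) (sat? : (φ : Formula (Theory.Atom T)) → Dec (Theory.Sat T φ)) where
  open Theory T
  open RM T sat?
  open Entailment T

  mutual
    rm-sound : ∀ τ φ C → C ∈ 𝒮 (rm τ φ) → C ∈ 𝒮 τ × ¬ (φ ⊨ C)
    rm-sound τ φ C p with sat? φ
    ... | no _    with p
    ...   | ()
    rm-sound τ φ C p | yes sat = rm′-sound τ φ sat C p

    rm′-sound : ∀ τ φ → Sat φ → ∀ C → C ∈ 𝒮 (rm′ τ φ) → C ∈ 𝒮 τ × ¬ (φ ⊨ C)
    rm′-sound bot       φ sat C (here refl) = here refl , sat⇒⊭⊥ φ sat
    rm′-sound (node ps) φ sat C p           = rmL-sound ps φ C p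

    rmL-sound : ∀ ps φ C → C ∈ 𝒮L (rmL ps φ) → C ∈ 𝒮L ps × ¬ (φ ⊨ C)
    rmL-sound ((l , t) ∷ ps) φ C p
      with Branch.view l (𝒮 (rm t (φ ∧F litF (‾ l)))) (𝒮L (rmL ps φ)) p
    ... | Branch.child {C′} q =
          let (C′∈t , ⊭C′) = rm-sound t (φ ∧F litF (‾ l)) C′ q
          in Branch.child⁺ l (𝒮 t) (𝒮L ps) C′∈t
           , λ ⊨lC′ → ⊭C′ (Equivalence.to (⊨-peel φ l C′) ⊨lC′)
    ... | Branch.rest q =
          let (C∈ps , ⊭C) = rmL-sound ps φ C q
          in Branch.rest⁺ l (𝒮 t) (𝒮L ps) C∈ps , ⊭C

  mutual
    rm-complete : ∀ τ φ C → C ∈ 𝒮 τ → ¬ (φ ⊨ C) → C ∈ 𝒮 (rm τ φ)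
    rm-complete τ φ C p ⊭C with sat? φ
    ... | no ¬sat = ⊥-elim (⊭C (unsat⇒⊨ φ ¬sat C))
    ... | yes _   = rm′-complete τ φ C p ⊭C

    rm′-complete : ∀ τ φ C → C ∈ 𝒮 τ → ¬ (φ ⊨ C) → C ∈ 𝒮 (rm′ τ φ)
    rm′-complete bot       φ C p ⊭C = p
    rm′-complete (node ps) φ C p ⊭C = rmL-complete ps φ C p ⊭C

    rmL-complete : ∀ ps φ C → C ∈ 𝒮L ps → ¬ (φ ⊨ C) → C ∈ 𝒮L (rmL ps φ)
    rmL-complete ((l , t) ∷ ps) φ C p ⊭C with Branch.view l (𝒮 t) (𝒮L ps) p
    ... | Branch.child {C′} q =
          Branch.child⁺ l (𝒮 (rm t φ′)) (𝒮L (rmL ps φ))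
            (rm-complete t φ′ C′ q (λ ⊨C′ → ⊭C (Equivalence.from (⊨-peel φ l C′) ⊨C′)))
      where φ′ = φ ∧F litF (‾ l)
    ... | Branch.rest q =
          Branch.rest⁺ l (𝒮 (rm t (φ ∧F litF (‾ l)))) (𝒮L (rmL ps φ))
            (rmL-complete ps φ C q ⊭C)

  rmL-labels : ∀ ps φ → map proj₁ (rmL ps φ) ≡ map proj₁ ps
  rmL-labels []             φ = refl
  rmL-labels ((l , t) ∷ ps) φ = cong (l ∷_) (rmL-labels ps φ)

  module _ {P : Lit Atom → Set} where
    mutual
      rm-lits : ∀ τ φ → All P (lits τ) → All P (lits (rm τ φ))
      rm-lits τ φ a with sat? φ
      ... | no _  = []
      ... | yes _ = rm′-lits τ φ a

      rm′-lits : ∀ τ φ → All P (lits τ) → All P (lits (rm′ τ φ))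
      rm′-lits bot       φ a = []
      rm′-lits (node ps) φ a = rmL-lits ps φ a

      rmL-lits : ∀ ps φ → All P (litsL ps) → All P (litsL (rmL ps φ))
      rmL-lits []             φ a        = []
      rmL-lits ((l , t) ∷ ps) φ (pl ∷ a) =
        let (at , aps) = ++⁻ (lits t) a
        in pl ∷ ++⁺ (rm-lits t (φ ∧F litF (‾ l)) at) (rmL-lits ps φ aps)

  module _ (𝒜 : List (Lit Atom)) (_<t_ : Lit Atom → Lit Atom → Set) where
    mutual
      rm-isTree : ∀ τ φ → IsTree 𝒜 _<t_ τ → IsTree 𝒜 _<t_ (rm τ φ)
      rm-isTree τ φ wf with sat? φ
      ... | no _  = node-tree [] []
      ... | yes _ = rm′-isTree τ φ wf

      rm′-isTree : ∀ τ φ → IsTree 𝒜 _<t_ τ → IsTree 𝒜 _<t_ (rm′ τ φ)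
      rm′-isTree bot       φ wf                = bot-tree
      rm′-isTree (node ps) φ (node-tree u wfs) =
        node-tree (subst Unique (sym (rmL-labels ps φ)) u) (rmL-isTree ps φ wfs)

      rmL-isTree : ∀ ps φ → IsTreeL 𝒜 _<t_ ps → IsTreeL 𝒜 _<t_ (rmL ps φ)
      rmL-isTree []             φ []                       = []
      rmL-isTree ((l , t) ∷ ps) φ ((l∈𝒜 , wf , l<t) ∷ wfs) =
        (l∈𝒜 , rm-isTree t φ′ wf , rm-lits t φ′ l<t) ∷ rmL-isTree ps φ wfs
        where φ′ = φ ∧F litF (‾ l)

lemma6 : (T : Theory) →
    (sat? : (φ : Formula (Theory.Atom T)) → Dec (Theory.Sat T φ)) →
    (𝒜 : List (Lit (Theory.Atom T))) →
    (_<t_ : Lit (Theory.Atom T) → Lit (Theory.Atom T) → Set) →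
    IsStrictTotalOrderOn 𝒜 _<t_ →
    (φ : Formula (Theory.Atom T)) → (τ : Tree (Lit (Theory.Atom T))) →
    IsTree 𝒜 _<t_ τ →
    IsTree 𝒜 _<t_ (RM.rm T sat? τ φ)
    × ((C : Theory.Clause T) →
    (C ∈ 𝒮 (RM.rm T sat? τ φ)) ⇔ ((C ∈ 𝒮 τ) × ¬ (Theory._⊨_ T φ C)))
lemma6 T sat? 𝒜 _<t_ _ φ τ wf =
    rm-isTree 𝒜 _<t_ τ φ wf
  , λ C → mk⇔ (rm-sound τ φ C) (λ (C∈τ , ⊭C) → rm-complete τ φ C C∈τ ⊭C)
  where open Removal T sat?
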